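{- Let $S[1..n]$ be a string, $k\geq1$ and $\Gamma\subseteq[1..n]$. Then $\Gamma$ is a $k$-attractor of $S$ if and only if for every edge $e$ of the suffix tree of $S$ with $\lambda(e)\leq k$ there exists $j\in\Gamma$ that marks $e$.
   Context: $\Gamma$ is a $k$-attractor of $S$ if every substring $S[i..j]$ with $i\leq j<i+k$ has an occurrence $S[i'..j']=S[i..j]$ with $j''\in[i'..j']$ for some $j''\in\Gamma$. For an edge $e=\langle u,v\rangle$ of the suffix tree of $S$, $s(e)$ is the string read from the root to the first character of the label of $e$, and $\lambda(e)=|s(e)|$. A position $j$ marks $e$ if there is an occurrence $S[i..i+\lambda(e)-1]=s(e)$ (i.e., $i$ is in the suffix array range of suffixes prefixed by $s(e)$) with $i\leq j<i+\lambda(e)$. -}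

module Defs where

open import Data.Nat using (ℕ; _+_; _≤_; _<_)
open import Data.List using (List; []; _∷_; _++_; [_]; length; take; drop)
open import Data.Fin using (Fin; toℕ)
open import Data.Fin.Subset using (Subset; _∈_)
open import Data.Product using (Σ; ∃; _×_)
open import Data.Sum using (_⊎_)
open import Relation.Binary.PropositionalEquality using (_≡_; _≢_)

-- Conventions: strings are lists; positions are 0-based (position p here is
-- position p+1 in the paper).  Γ ⊆ [1..n] is a Subset of Fin n, n = length S.

-- w occurs in S starting at (0-based) position i, i.e. S[i..i+|w|-1] = w.
-- (take returns a shorter list if the occurrence would run past the end.)
OccursAt : {A : Set} → List A → ℕ → List A → Set
OccursAt S i w = take (length w) (drop i S) ≡ w

IsSubstring : {A : Set} → List A → List A → Set
IsSubstring S w = ∃ λ i → OccursAt S i w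

substr : {A : Set} → List A → ℕ → ℕ → List A
substr S i len = take len (drop i S)

-- Γ is a k-attractor of S: every substring S[i..j] with i ≤ j < i+k
-- (written here with len = j-i+1, 1 ≤ len ≤ k, i+len ≤ n) has an occurrence
-- S[i'..i'+len-1] containing a position of Γ.
IsAttractor : {A : Set} (S : List A) → ℕ → Subset (length S) → Set
IsAttractor S k Γ =
  ∀ (i len : ℕ) → 1 ≤ len → len ≤ k → i + len ≤ length S →
    Σ ℕ λ i' → OccursAt S i' (substr S i len) ×
      Σ (Fin (length S)) λ p → p ∈ Γ × i' ≤ toℕ p × toℕ p < i' + len

-- Explicit nodes of the suffix tree of S (compacted trie of all suffixes of S),
-- identified with their string labels: the root, the right-branching
-- substrings (internal branching nodes), and the suffixes of S (leaves; for a
-- $-terminated S these are exactly the leaves).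
RightBranching : {A : Set} → List A → List A → Set
RightBranching S x = Σ _ λ c → Σ _ λ c' → c ≢ c' ×
  IsSubstring S (x ++ [ c ]) × IsSubstring S (x ++ [ c' ])

IsSuffix : {A : Set} → List A → List A → Set
IsSuffix S x = ∃ λ i → drop i S ≡ x

IsNode : {A : Set} → List A → List A → Set
IsNode S x = x ≡ [] ⊎ RightBranching S x ⊎ IsSuffix S x

-- An edge e = ⟨u,v⟩ of the suffix tree is determined by its origin node u and
-- the first character c of its label; every node u has exactly one outgoing
-- edge for each c such that u·c occurs in S.
IsEdge : {A : Set} → List A → List A → A → Set
IsEdge S u c = IsNode S u × IsSubstring S (u ++ [ c ])

sₑ : {A : Set} → List A → A → List A
sₑ u c = u ++ [ c ]

λₑ : {A : Set} → List A → A → ℕ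
λₑ u c = length (sₑ u c)

Marks : {A : Set} → List A → ℕ → List A → A → Set
Marks S j u c = Σ ℕ λ i → OccursAt S i (sₑ u c) × i ≤ j × j < i + λₑ u c

-- An occurrence of a string x can be shrunk to the shortest prefix u·c of x whose
-- occurrences all extend to occurrences of x. Either u is empty (the root), or
-- some occurrence of u is not followed by c, so u is a suffix of S or is followed
-- by two different characters: in every case u is a node and ⟨u,c⟩ an edge. A
-- position of Γ marking this edge therefore lies inside an occurrence of x.
-- Conversely, s(e) is itself a substring of length λ(e) ≤ k.
module Submission where

open import Defs
open import Data.Nat using (ℕ; _≤_)
open import Data.List using (List; length)
open import Data.Fin using (Fin; toℕ)
open import Data.Fin.Subset using (Subset; _∈_)
open import Data.Product using (Σ; _×_)
open import Function.Bundles using (_⇔_)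
open import Relation.Binary.Definitions using (DecidableEquality)

open import Algebra.Properties.Monoid.Divisibility using ()
open import Data.Nat using (_+_; _<_; _∸_; _⊓_)
open import Data.Nat.Properties
  using (m⊓n≡m⇒m≤n; m≤n⇒m⊓n≡m; m≤o∸n⇒m+n≤o; m+n≤o⇒m≤o∸n; m∸n≢0⇒n<m; m<n⇒n≢0;
         +-comm; m<m+n; <-≤-trans; <⇒≤; m≤n+m; ≤-trans; +-monoʳ-≤; anyUpTo?)
open import Data.List using ([]; _∷_; _++_; [_]; _∷ʳ_; take; drop)
open import Data.List.Properties
  using (++-monoid; length-++; length-drop; length-take; take++drop≡id; ++-identityʳ; ∷ʳ-++; ≡-dec)
open import Data.List.Reverse using (Reverse; []; _∶_∶ʳ_; reverseView)
open import Data.List.Relation.Binary.Prefix.Heterogeneous.Properties using (length-mono)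
open import Data.List.Relation.Binary.Prefix.Propositional.Properties using (∣ˡ-as-Prefix)
open import Data.Product using (_,_)
open import Data.Sum using (_⊎_; inj₁; inj₂)
open import Function.Base using (_∘_)
open import Function.Bundles using (mk⇔)
open import Relation.Nullary using (Dec; ¬_)
open import Relation.Nullary.Decidable using (yes; no; ¬?; _×-dec_; decidable-stable)
open import Relation.Binary.PropositionalEquality
  using (_≡_; refl; sym; trans; cong; subst; module ≡-Reasoning)

module _ {A : Set} where

  -- In the monoid (List A, _++_, []), w ∣ˡ v says that w is a prefix of v.
  open Algebra.Properties.Monoid.Divisibility (++-monoid A)
    using (_∣ˡ_; _,_; ∣ˡ-refl; ∣ˡ-trans; x∣ˡxy)

  take-length-++ : (xs ys : List A) → take (length xs) (xs ++ ys) ≡ xs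
  take-length-++ []       ys = refl
  take-length-++ (x ∷ xs) ys = cong (x ∷_) (take-length-++ xs ys)

  length-∷ʳ-positive : (u : List A) (c : A) → 1 ≤ length (u ∷ʳ c)
  length-∷ʳ-positive u c = subst (1 ≤_) (sym (length-++ u)) (m≤n+m 1 (length u))

  module _ (S : List A) where

    occursAt⇒∣ˡ : ∀ q {w} → OccursAt S q w → w ∣ˡ drop q S
    occursAt⇒∣ˡ q {w} occ = drop (length w) (drop q S) , (begin
      w ++ drop (length w) (drop q S)
        ≡⟨ cong (_++ drop (length w) (drop q S)) (sym occ) ⟩
      take (length w) (drop q S) ++ drop (length w) (drop q S)
        ≡⟨ take++drop≡id (length w) (drop q S) ⟩
      drop q S ∎)
      where open ≡-Reasoning

    ∣ˡ⇒occursAt : ∀ q {w} → w ∣ˡ drop q S → OccursAt S q w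
    ∣ˡ⇒occursAt q {w} (rest , eq) =
      trans (cong (take (length w)) (sym eq)) (take-length-++ w rest)

    occursAt-∣ˡ : ∀ q {w v} → w ∣ˡ v → OccursAt S q v → OccursAt S q w
    occursAt-∣ˡ q w∣v occ = ∣ˡ⇒occursAt q (∣ˡ-trans w∣v (occursAt⇒∣ˡ q occ))

    isSubstring-∣ˡ : ∀ {w v} → w ∣ˡ v → IsSubstring S v → IsSubstring S w
    isSubstring-∣ˡ w∣v (q , occ) = q , occursAt-∣ˡ q w∣v occ

    occursAt-length : ∀ q {w} → OccursAt S q w → length w ≤ length S ∸ q
    occursAt-length q {w} occ = m⊓n≡m⇒m≤n (begin
      length w ⊓ (length S ∸ q)       ≡⟨ cong (length w ⊓_) (sym (length-drop q S)) ⟩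
      length w ⊓ length (drop q S)    ≡⟨ sym (length-take (length w) (drop q S)) ⟩
      length (take (length w) (drop q S)) ≡⟨ cong length occ ⟩
      length w ∎)
      where open ≡-Reasoning

    occursAt-bound : ∀ q {w} → 1 ≤ length w → OccursAt S q w → q + length w ≤ length S
    occursAt-bound q {w} 1≤w occ =
      subst (_≤ length S) (+-comm (length w) q) (m≤o∸n⇒m+n≤o (length w) (<⇒≤ q<S) w≤)
      where
      w≤ : length w ≤ length S ∸ q
      w≤ = occursAt-length q occ
      q<S : q < length S
      q<S = m∸n≢0⇒n<m (m<n⇒n≢0 (≤-trans 1≤w w≤))

    length-substr : ∀ i len → i + len ≤ length S → length (substr S i len) ≡ len
    length-substr i len bound = begin
      length (take len (drop i S))   ≡⟨ length-take len (drop i S) ⟩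
      len ⊓ length (drop i S)        ≡⟨ cong (len ⊓_) (length-drop i S) ⟩
      len ⊓ (length S ∸ i)           ≡⟨ m≤n⇒m⊓n≡m len≤ ⟩
      len ∎
      where
      open ≡-Reasoning
      len≤ : len ≤ length S ∸ i
      len≤ = m+n≤o⇒m≤o∸n len (subst (_≤ length S) (+-comm i len) bound)

    Determines : List A → List A → Set
    Determines w x = ∀ q → OccursAt S q w → OccursAt S q x

    escape⇒isNode : ∀ q {u c} → OccursAt S q u → ¬ OccursAt S q (u ∷ʳ c) →
                    IsSubstring S (u ∷ʳ c) → IsNode S u
    escape⇒isNode q {u} {c} occ ¬occ sub with occursAt⇒∣ˡ q occ
    ... | []    , eq = inj₂ (inj₂ (q , trans (sym eq) (++-identityʳ u)))
    ... | d ∷ r , eq = inj₂ (inj₁ (c , d , c≢d , sub , q , ∣ˡ⇒occursAt q (r , trans (∷ʳ-++ u d r) eq)))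
      where
      c≢d : ¬ c ≡ d
      c≢d refl = ¬occ (∣ˡ⇒occursAt q (r , trans (∷ʳ-++ u c r) eq))

    EdgesMarkedUpTo : ℕ → Subset (length S) → Set
    EdgesMarkedUpTo k Γ = ∀ u c → IsEdge S u c → λₑ u c ≤ k →
      Σ (Fin (length S)) λ j → j ∈ Γ × Marks S (toℕ j) u c

    Captures : Subset (length S) → List A → ℕ → Set
    Captures Γ x len = Σ ℕ λ i′ → OccursAt S i′ x ×
      Σ (Fin (length S)) λ p → p ∈ Γ × i′ ≤ toℕ p × toℕ p < i′ + len

    module _ (_≟_ : DecidableEquality A) where

      occursAt? : ∀ q w → Dec (OccursAt S q w)
      occursAt? q w = ≡-dec _≟_ (take (length w) (drop q S)) w

      -- Occurrences of a nonempty word start before length S, so the search is finite.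
      determines-or-escapes : ∀ w x → 1 ≤ length w →
        Determines w x ⊎ Σ ℕ λ q → OccursAt S q w × ¬ OccursAt S q x
      determines-or-escapes w x 1≤w
        with anyUpTo? (λ q → occursAt? q w ×-dec ¬? (occursAt? q x)) (length S)
      ... | yes (q , _ , occ , ¬occ) = inj₂ (q , occ , ¬occ)
      ... | no none = inj₁ λ q occ → decidable-stable (occursAt? q x) λ ¬occ →
        none (q , <-≤-trans (m<m+n q 1≤w) (occursAt-bound q 1≤w occ) , occ , ¬occ)

      determining-edge : ∀ {u} → Reverse u → ∀ c → IsSubstring S (u ∷ʳ c) →
        Σ (List A) λ v → Σ A λ d →
          IsEdge S v d × v ∷ʳ d ∣ˡ u ∷ʳ c × Determines (v ∷ʳ d) (u ∷ʳ c)
      determining-edge [] c sub = [] , c , (inj₁ refl , sub) , ∣ˡ-refl , λ _ occ → occ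
      determining-edge (u ∶ ru ∶ʳ a) c sub
        with determines-or-escapes (u ∷ʳ a) ((u ∷ʳ a) ∷ʳ c) (length-∷ʳ-positive u a)
      ... | inj₂ (q , occ , ¬occ) =
        u ∷ʳ a , c , (escape⇒isNode q occ ¬occ sub , sub) , ∣ˡ-refl , λ _ occ′ → occ′
      ... | inj₁ det with determining-edge ru a (isSubstring-∣ˡ (x∣ˡxy (u ∷ʳ a) [ c ]) sub)
      ...   | v , d , edge , v∣u , det′ =
        v , d , edge , ∣ˡ-trans v∣u (x∣ˡxy (u ∷ʳ a) [ c ]) , λ q → det q ∘ det′ q

      edgesMarked⇒captures : ∀ {k Γ} → EdgesMarkedUpTo k Γ → ∀ {x} → Reverse x →
        1 ≤ length x → length x ≤ k → IsSubstring S x → Captures Γ x (length x)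
      edgesMarked⇒captures marked [] ()
      edgesMarked⇒captures marked (u ∶ ru ∶ʳ c) _ x≤k sub with determining-edge ru c sub
      ... | v , d , edge , vd∣x , det
        with marked v d edge (≤-trans (length-mono (∣ˡ-as-Prefix vd∣x)) x≤k)
      ... | j , j∈Γ , i′ , occ , i′≤j , j<i′+λ =
        i′ , det i′ occ , j , j∈Γ , i′≤j ,
        <-≤-trans j<i′+λ (+-monoʳ-≤ i′ (length-mono (∣ˡ-as-Prefix vd∣x)))

      edgesMarked⇒isAttractor : ∀ {k Γ} → EdgesMarkedUpTo k Γ → IsAttractor S k Γ
      edgesMarked⇒isAttractor {k} {Γ} marked i len 1≤len len≤k bound =
        subst (Captures Γ x) x≡len
          (edgesMarked⇒captures marked (reverseView x)
            (subst (1 ≤_) (sym x≡len) 1≤len) (subst (_≤ k) (sym x≡len) len≤k)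
            (i , cong (λ n → take n (drop i S)) x≡len))
        where
        x : List A
        x = substr S i len
        x≡len : length x ≡ len
        x≡len = length-substr i len bound

    isAttractor⇒edgesMarked : ∀ {k Γ} → IsAttractor S k Γ → EdgesMarkedUpTo k Γ
    isAttractor⇒edgesMarked att u c (_ , i , occ) λ≤k
      with att i (λₑ u c) (length-∷ʳ-positive u c) λ≤k
             (occursAt-bound i (length-∷ʳ-positive u c) occ)
    ... | i′ , occ′ , j , j∈Γ , i′≤j , j<i′+λ =
      j , j∈Γ , i′ , subst (OccursAt S i′) occ occ′ , i′≤j , j<i′+λ

lemma11 : {A : Set} → DecidableEquality A → (S : List A) (k : ℕ) → 1 ≤ k →
    (Γ : Subset (length S)) →
    IsAttractor S k Γ ⇔
      (∀ (u : List A) (c : A) → IsEdge S u c → λₑ u c ≤ k →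
        Σ (Fin (length S)) λ j → j ∈ Γ × Marks S (toℕ j) u c)
lemma11 _≟_ S k _ Γ = mk⇔ (isAttractor⇒edgesMarked S) (edgesMarked⇒isAttractor S _≟_)
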